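{- Let $\mathbf{K}$ be a relational Fraïssé structure with universe $\mathbb{N}$ and $G=\mathrm{Aut}(\mathbf{K})$. The right action of $G$ on $\varprojlim\beta H_n$ defined by: for $\alpha\in\varprojlim\beta H_n$, $g\in G$, $m\in\mathbb{N}$ and $S\subseteq H_m$, with $n$ large enough that $\mathbf{A}_m\cup g(\mathbf{A}_m)\subseteq\mathbf{A}_n$, $$S\in(\alpha g)(m)\iff\{f\in H_n: f\circ g|_{\mathbf{A}_m}\in S\}\in\alpha(n),$$ is jointly continuous when $G$ carries the pointwise convergence topology.
   Context: A Fraïssé structure is a countably infinite locally finite ultrahomogeneous structure. For $n\in\mathbb{N}$, $\mathbf{A}_n$ is the substructure of $\mathbf{K}$ on $\{1,\dots,n\}$ and $H_n$ is the set of embeddings $\mathbf{A}_n\to\mathbf{K}$, viewed as a discrete space; $\beta H_n$ is its Stone–Čech compactification (space of ultrafilters on $H_n$, basic open sets $\{p: A\in p\}$). For $m\le n$ let $i^n_m$ be the inclusion $\mathbf{A}_m\hookrightarrow\mathbf{A}_n$, $\hat{i}^n_m:H_n\to H_m$, $x\mapsto x\circ i^n_m$, and $\tilde{i}^n_m:\beta H_n\to\beta H_m$ its continuous extension (push-forward of ultrafilters). $\varprojlim\beta H_n=\{\alpha\in\prod_n\beta H_n:\tilde{i}^n_m(\alpha(n))=\alpha(m)\text{ for all }m\le n\}$ with the subspace topology of the product. The displayed formula is independent of the choice of $n$ and defines a right action of $G$. -}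

module Defs where

open import Level using (Level; 0ℓ) renaming (suc to lsuc)
open import Data.Nat using (ℕ; zero; suc; _≤_; _<_; _⊔_)
open import Data.Fin using (Fin; toℕ)
open import Data.Vec using (Vec; []; _∷_; lookup; map; tabulate)
open import Data.Product using (Σ; _×_; _,_; ∃)
open import Data.Sum using (_⊎_)
open import Data.Unit using (⊤)
open import Data.Empty using (⊥)
open import Data.List using (List)
open import Data.List.Relation.Unary.All using (All)
open import Relation.Nullary using (¬_)
open import Relation.Binary.PropositionalEquality using (_≡_)
open import Function.Bundles using (_⇔_)

record Signature : Set₁ where
  field
    Sym   : Set
    arity : Sym → ℕ
open Signature public

-- A relational structure for the signature with universe ℕ.
-- (Universe ℕ = {0,1,2,...}; the paper's {1,...,n} is our {0,...,n-1}.)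
record Structure (L : Signature) : Set₁ where
  field
    Rel : (r : Sym L) → Vec ℕ (arity L r) → Set
open Structure public

module _ {L : Signature} (K : Structure L) where

  record Aut : Set where
    field
      fun    : ℕ → ℕ
      inv    : ℕ → ℕ
      inv-l  : ∀ x → inv (fun x) ≡ x
      inv-r  : ∀ x → fun (inv x) ≡ x
      pres   : ∀ (r : Sym L) (u : Vec ℕ (arity L r)) →
               Rel K r u ⇔ Rel K r (map fun u)
  open Aut public

  InjectiveVec : ∀ {k} → Vec ℕ k → Set
  InjectiveVec {k} a = ∀ (j j′ : Fin k) → lookup a j ≡ lookup a j′ → j ≡ j′

  -- Ultrahomogeneity: every isomorphism between finite substructures
  -- (given by enumerations a, b of their universes, a_j ↦ b_j) extends
  -- to an automorphism.
  Ultrahomogeneous : Set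
  Ultrahomogeneous =
    ∀ (k : ℕ) (a b : Vec ℕ k) → InjectiveVec a → InjectiveVec b →
    (∀ (r : Sym L) (u : Vec (Fin k) (arity L r)) →
       Rel K r (map (lookup a) u) ⇔ Rel K r (map (lookup b) u)) →
    Σ Aut λ g → ∀ (j : Fin k) → fun g (lookup a j) ≡ lookup b j

  -- K is a Fraïssé structure (universe ℕ is countably infinite; a relational
  -- structure is automatically locally finite).
  IsFraisse : Set
  IsFraisse = Ultrahomogeneous

  -- An element v : Vec ℕ n represents the map A_n → K, j ↦ v_j.
  -- It is in H_n iff it is an embedding of A_n (the substructure on {0..n-1}).
  IsEmb : ∀ {n} → Vec ℕ n → Set
  IsEmb {n} v =
    InjectiveVec v ×
    (∀ (r : Sym L) (u : Vec (Fin n) (arity L r)) →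
       Rel K r (map toℕ u) ⇔ Rel K r (map (lookup v) u))

  -- Subsets of H_n are represented by predicates on Vec ℕ n (only their
  -- trace on H_n matters, as enforced by the ultrafilter axioms below).
  Sub : ℕ → Set₁
  Sub n = Vec ℕ n → Set

  record Ultra (n : ℕ) : Set₁ where
    field
      _∋_    : Sub n → Set
      up     : ∀ {S T : Sub n} → _∋_ S →
               (∀ v → IsEmb v → S v → T v) → _∋_ T
      inter  : ∀ {S T : Sub n} → _∋_ S → _∋_ T → _∋_ (λ v → S v × T v)
      whole  : _∋_ IsEmb
      proper : ¬ (_∋_ (λ _ → ⊥))
      ultra  : ∀ (S : Sub n) → _∋_ S ⊎ _∋_ (λ v → ¬ S v)
  open Ultra public

  -- lookup with default (only used at in-range indices)
  lookupD : ∀ {n} → Vec ℕ n → ℕ → ℕ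
  lookupD []       _       = 0
  lookupD (x ∷ v)  zero    = x
  lookupD (x ∷ v)  (suc j) = lookupD v j

  restrict : ∀ {n} (m : ℕ) → Vec ℕ n → Vec ℕ m
  restrict m f = tabulate (λ (j : Fin m) → lookupD f (toℕ j))

  record Lim : Set₁ where
    field
      at  : (n : ℕ) → Ultra n
      coh : ∀ (m n : ℕ) → m ≤ n → ∀ (S : Sub m) →
            (at m ∋ S) ⇔ (at n ∋ (λ f → S (restrict m f)))
  open Lim public

  -- A number n with A_m ∪ g(A_m) ⊆ A_n, i.e. m ≤ n and g j < n for j < m.
  bound : Aut → ℕ → ℕ
  bound g zero    = zero
  bound g (suc m) = suc m ⊔ suc (fun g m) ⊔ bound g m

  compRestr : ∀ {n} → Aut → (m : ℕ) → Vec ℕ n → Vec ℕ m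
  compRestr g m f = tabulate (λ (j : Fin m) → lookupD f (fun g (toℕ j)))

  actMem : Lim → Aut → (m : ℕ) → Sub m → Set
  actMem α g m S =
    at α (bound g m) ∋ (λ f → IsEmb f × S (compRestr g m f))

  -- A basic open set of lim← βH_n (finite intersection of subbasic sets
  -- {β : S ∈ β(m)} of the product topology restricted to the limit).
  BasicCond : Set₁
  BasicCond = Σ ℕ Sub

  SatL : Lim → List BasicCond → Set₁
  SatL β cs = All (λ (c : BasicCond) → at β (Data.Product.proj₁ c) ∋ Data.Product.proj₂ c) cs

  SatAct : Lim → Aut → List BasicCond → Set₁
  SatAct β h cs = All (λ (c : BasicCond) → actMem β h (Data.Product.proj₁ c) (Data.Product.proj₂ c)) cs

  -- Joint continuity of (α, g) ↦ α g : lim← βH_n × G → lim← βH_n, where G has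
  -- the pointwise convergence topology (basic neighbourhoods of g:
  -- {h : h x = g x for all x < k}), stated via basic neighbourhoods at each point.
  JointlyContinuousAction : Set₁
  JointlyContinuousAction =
    ∀ (α : Lim) (g : Aut) (U : List BasicCond) → SatAct α g U →
    Σ (List BasicCond) λ V → SatL α V × Σ ℕ λ k →
      ∀ (β : Lim) (h : Aut) → SatL β V →
        (∀ x → x < k → fun h x ≡ fun g x) → SatAct β h U

-- The action is continuous because it is "local" on both factors. The value
-- of α g at level m is determined by α at the single level bound g m, through
-- the subset {f ∈ H_n : f ∘ g|A_m ∈ S}; and both bound g m and f ∘ g|A_m only
-- depend on g restricted to A_m. So if α g satisfies finitely many basic
-- conditions (m, S), then the corresponding pulled-back conditions on α, together
-- with agreement with g on A_k for k the largest of the m's, form a basic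
-- neighbourhood of (α, g) mapped into the given one.
module Submission where

open import Defs
open import Data.Nat using (ℕ; zero; suc; _≤_; _<_; _⊔_)
open import Data.Nat.Properties using (<-≤-trans; n<1+n; <-trans)
open import Data.Fin using (toℕ)
open import Data.Fin.Properties using (toℕ<n)
open import Data.Vec using (Vec)
open import Data.Vec.Properties using (tabulate-cong)
open import Data.Product using (_×_; _,_; proj₁; proj₂)
open import Data.List using (List; map)
open import Data.List.Extrema.Nat using (max; xs≤max)
open import Data.List.Relation.Unary.All using (zipWith)
open import Data.List.Relation.Unary.All.Properties using (map⁺; map⁻)
open import Relation.Binary.PropositionalEquality using (_≡_; refl; sym; cong; cong₂; subst)

module _ {L : Signature} (K : Structure L) where

  AgreeBelow : ℕ → Aut K → Aut K → Set
  AgreeBelow k g h = ∀ x → x < k → fun h x ≡ fun g x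

  agreeBelow-mono : ∀ {j k} {g h : Aut K} → j ≤ k → AgreeBelow k g h → AgreeBelow j g h
  agreeBelow-mono j≤k agree x x<j = agree x (<-≤-trans x<j j≤k)

  bound-cong : ∀ {g h : Aut K} m → AgreeBelow m g h → bound K h m ≡ bound K g m
  bound-cong zero    _     = refl
  bound-cong (suc m) agree =
    cong₂ (λ a b → suc m ⊔ suc a ⊔ b)
      (agree m (n<1+n m))
      (bound-cong m (λ x x<m → agree x (<-trans x<m (n<1+n m))))

  compRestr-cong : ∀ {g h : Aut K} m {n} (f : Vec ℕ n) → AgreeBelow m g h →
                   compRestr K h m f ≡ compRestr K g m f
  compRestr-cong m f agree =
    tabulate-cong (λ j → cong (lookupD K f) (agree (toℕ j) (toℕ<n j)))

  actMem-local : ∀ (β : Lim K) {g h : Aut K} m (S : Sub K m) → AgreeBelow m g h →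
                 actMem K β g m S → actMem K β h m S
  actMem-local β {g} {h} m S agree β∋ =
    subst (λ n → at β n ∋ pullback h) (sym (bound-cong m agree))
      (up (at β (bound K g m)) β∋
        (λ f _ (emb , s) → emb , subst S (sym (compRestr-cong {g} {h} m f agree)) s))
    where
    pullback : ∀ {n} → Aut K → Sub K n
    pullback g′ f = IsEmb K f × S (compRestr K g′ m f)

  -- Rewrites the condition "S ∈ (β g)(m)" as a basic condition on β itself.
  pullbackCond : Aut K → BasicCond K → BasicCond K
  pullbackCond g c =
    bound K g (proj₁ c) , λ f → IsEmb K f × proj₂ c (compRestr K g (proj₁ c) f)

  satAct⇒satL-pullback : ∀ (β : Lim K) g U → SatAct K β g U → SatL K β (map (pullbackCond g) U)
  satAct⇒satL-pullback β g U = map⁺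

  depth : List (BasicCond K) → ℕ
  depth U = max 0 (map proj₁ U)

  satL-pullback⇒satAct : ∀ (β : Lim K) {g h} U → SatL K β (map (pullbackCond g) U) →
                         AgreeBelow (depth U) g h → SatAct K β h U
  satL-pullback⇒satAct β {g} {h} U sat agree =
    zipWith (λ {c} (m≤depth , β∋) →
              actMem-local β (proj₁ c) (proj₂ c) (agreeBelow-mono {g = g} {h} m≤depth agree) β∋)
      (map⁻ (xs≤max 0 (map proj₁ U)) , map⁻ sat)

proposition6p2 : (L : Signature) (K : Structure L) → IsFraisse K → JointlyContinuousAction K
proposition6p2 L K _ α g U sat =
  map (pullbackCond K g) U , satAct⇒satL-pullback K α g U sat , depth K U ,
  λ β h satβ agree → satL-pullback⇒satAct K β U satβ agree
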